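{- Let $k$ be a natural number. (1) For every $\varphi\in\Pi_k$ there exists $\psi\in\Sigma_k$ with $\mathrm{FV}(\varphi)=\mathrm{FV}(\psi)$ and $\mathsf{HA}+\mathrm{DNE}(\Sigma_k)\vdash\neg\varphi\leftrightarrow\psi$. (2) For every $\varphi\in\Sigma_k$ there exists $\psi\in\Pi_k$ with $\mathrm{FV}(\varphi)=\mathrm{FV}(\psi)$ and $\mathsf{HA}+\mathrm{DNE}(\Sigma_{k-1})$ (just $\mathsf{HA}$ if $k=0$) proves $\neg\varphi\leftrightarrow\psi$.
   Context: $\mathsf{HA}$ is intuitionistic (Heyting) arithmetic in the language with function symbols for all primitive recursive functions and logical constants $\forall,\exists,\to,\land,\lor,\perp$; $\neg\varphi$ abbreviates $\varphi\to\perp$. $S+\mathrm{P}$ adds all instances of schema $\mathrm{P}$ to $S$. $\mathrm{FV}(\varphi)$ is the set of free variables. $\Sigma_0=\Pi_0$ are the quantifier-free formulas; $\Pi_{k+1}$: formulas $Q_1\bar x_1\cdots Q_{k+1}\bar x_{k+1}\varphi_{qf}$ ($Q_i=\forall$ for odd $i$, $\exists$ for even $i$); $\Sigma_{k+1}$ likewise starting with $\exists$ (blocks may be empty by the paper's convention). $\mathrm{DNE}(\Gamma)$: $\forall x(\neg\neg\varphi(x)\to\varphi(x))$ for $\varphi(x)\in\Gamma$ with free variables among $x$. -}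

module Defs where

open import Data.Nat using (ℕ; zero; suc; _<_; _+_)
open import Data.Fin using (Fin)
open import Data.Vec using (Vec; []; _∷_; lookup; tabulate)
open import Data.List using (List; []; _∷_)
import Data.List as List
open import Data.List.Membership.Propositional using (_∈_)
open import Data.Product using (Σ; Σ-syntax; _×_; _,_)
open import Data.Sum using (_⊎_)
open import Relation.Binary.PropositionalEquality using (_≡_)

data PR : ℕ → Set where
  Zr   : PR 0
  Sc   : PR 1
  Pj   : ∀ {n} → Fin n → PR n
  Cmp  : ∀ {m n} → PR m → Vec (PR n) m → PR n
  Rec  : ∀ {n} → PR n → PR (suc (suc n)) → PR (suc n)
    -- Rec g h (0 , xs) = g xs ; Rec g h (S y , xs) = h (y , Rec g h (y , xs) , xs)

-- Terms and formulas (de Bruijn indices for variables)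

data Term : Set where
  var : ℕ → Term
  app : ∀ {n} → PR n → Vec Term n → Term

infixr 6 _∧'_
infixr 5 _∨'_
infixr 4 _⇒_
infix  7 _≐_

data Formula : Set where
  ⊥'   : Formula
  _≐_  : Term → Term → Formula
  _∧'_ : Formula → Formula → Formula
  _∨'_ : Formula → Formula → Formula
  _⇒_  : Formula → Formula → Formula
  ∀'   : Formula → Formula     -- binds de Bruijn index 0
  ∃'   : Formula → Formula

¬' : Formula → Formula
¬' φ = φ ⇒ ⊥'

_⇔_ : Formula → Formula → Formula
φ ⇔ ψ = (φ ⇒ ψ) ∧' (ψ ⇒ φ)

zero' : Term
zero' = app Zr []

succ' : Term → Term
succ' t = app Sc (t ∷ [])

mutual
  subT : (ℕ → Term) → Term → Term
  subT σ (var x)    = σ x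
  subT σ (app f ts) = app f (subTs σ ts)

  subTs : ∀ {n} → (ℕ → Term) → Vec Term n → Vec Term n
  subTs σ []       = []
  subTs σ (t ∷ ts) = subT σ t ∷ subTs σ ts

shiftT : Term → Term
shiftT = subT (λ x → var (suc x))

ext : (ℕ → Term) → ℕ → Term
ext σ zero    = var zero
ext σ (suc x) = shiftT (σ x)

sub : (ℕ → Term) → Formula → Formula
sub σ ⊥'       = ⊥'
sub σ (t ≐ u)  = subT σ t ≐ subT σ u
sub σ (φ ∧' ψ) = sub σ φ ∧' sub σ ψ
sub σ (φ ∨' ψ) = sub σ φ ∨' sub σ ψ
sub σ (φ ⇒ ψ)  = sub σ φ ⇒ sub σ ψ
sub σ (∀' φ)   = ∀' (sub (ext σ) φ)
sub σ (∃' φ)   = ∃' (sub (ext σ) φ)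

shift : Formula → Formula
shift = sub (λ x → var (suc x))

-- φ[t/0] : substitute t for variable 0, lowering the other variables
single : Term → ℕ → Term
single t zero    = t
single t (suc x) = var x

_[_] : Formula → Term → Formula
φ [ t ] = sub (single t) φ

mutual
  data _∈FVt_ (x : ℕ) : Term → Set where
    fv-var : x ∈FVt var x
    fv-app : ∀ {n} {f : PR n} {ts : Vec Term n} → x ∈FVts ts → x ∈FVt app f ts

  data _∈FVts_ (x : ℕ) : ∀ {n} → Vec Term n → Set where
    here  : ∀ {n t} {ts : Vec Term n} → x ∈FVt t → x ∈FVts (t ∷ ts)
    there : ∀ {n t} {ts : Vec Term n} → x ∈FVts ts → x ∈FVts (t ∷ ts)

data _∈FV_ (x : ℕ) : Formula → Set where
  fv-≐l : ∀ {t u} → x ∈FVt t → x ∈FV (t ≐ u)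
  fv-≐r : ∀ {t u} → x ∈FVt u → x ∈FV (t ≐ u)
  fv-∧l : ∀ {φ ψ} → x ∈FV φ → x ∈FV (φ ∧' ψ)
  fv-∧r : ∀ {φ ψ} → x ∈FV ψ → x ∈FV (φ ∧' ψ)
  fv-∨l : ∀ {φ ψ} → x ∈FV φ → x ∈FV (φ ∨' ψ)
  fv-∨r : ∀ {φ ψ} → x ∈FV ψ → x ∈FV (φ ∨' ψ)
  fv-⇒l : ∀ {φ ψ} → x ∈FV φ → x ∈FV (φ ⇒ ψ)
  fv-⇒r : ∀ {φ ψ} → x ∈FV ψ → x ∈FV (φ ⇒ ψ)
  fv-∀  : ∀ {φ} → suc x ∈FV φ → x ∈FV ∀' φ
  fv-∃  : ∀ {φ} → suc x ∈FV φ → x ∈FV ∃' φ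

SameFV : Formula → Formula → Set
SameFV φ ψ = ∀ x → (x ∈FV φ → x ∈FV ψ) × (x ∈FV ψ → x ∈FV φ)

FVBelow : ℕ → Formula → Set
FVBelow n φ = ∀ x → x ∈FV φ → x < n

∀ⁿ : ℕ → Formula → Formula
∀ⁿ zero    φ = φ
∀ⁿ (suc n) φ = ∀' (∀ⁿ n φ)

∃ⁿ : ℕ → Formula → Formula
∃ⁿ zero    φ = φ
∃ⁿ (suc n) φ = ∃' (∃ⁿ n φ)

UClosure : (Formula → Set) → Formula → Set
UClosure P φ = Σ[ n ∈ ℕ ] Σ[ ψ ∈ Formula ] P ψ × FVBelow n ψ × (φ ≡ ∀ⁿ n ψ)

data QF : Formula → Set where
  qf-⊥ : QF ⊥'
  qf-≐ : ∀ {t u} → QF (t ≐ u)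
  qf-∧ : ∀ {φ ψ} → QF φ → QF ψ → QF (φ ∧' ψ)
  qf-∨ : ∀ {φ ψ} → QF φ → QF ψ → QF (φ ∨' ψ)
  qf-⇒ : ∀ {φ ψ} → QF φ → QF ψ → QF (φ ⇒ ψ)

mutual
  -- Σₖ and Πₖ as in the paper: a block of like quantifiers (possibly empty)
  -- followed by a formula of the dual class one level down.
  data Sig : ℕ → Formula → Set where
    sig0 : ∀ {φ} → QF φ → Sig zero φ
    sigS : ∀ {k} m {φ} → Pi k φ → Sig (suc k) (∃ⁿ m φ)

  data Pi : ℕ → Formula → Set where
    pi0 : ∀ {φ} → QF φ → Pi zero φ
    piS : ∀ {k} m {φ} → Sig k φ → Pi (suc k) (∀ⁿ m φ)

vars : (n : ℕ) → Vec Term n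
vars n = tabulate (λ i → var (Data.Fin.toℕ i))

data PREq : Formula → Set where
  eq-Pj  : ∀ {n} (i : Fin n) → PREq (app (Pj i) (vars n) ≐ var (Data.Fin.toℕ i))
  eq-Cmp : ∀ {m n} (f : PR m) (gs : Vec (PR n) m) →
           PREq (app (Cmp f gs) (vars n) ≐
                 app f (Data.Vec.map (λ g → app g (vars n)) gs))
  eq-Rec0 : ∀ {n} (g : PR n) (h : PR (suc (suc n))) →
           PREq (app (Rec g h) (zero' ∷ vars n) ≐ app g (vars n))
  eq-RecS : ∀ {n} (g : PR n) (h : PR (suc (suc n))) →
           -- variables: y = var n, xs = var 0 .. var (n-1)
           PREq (app (Rec g h) (succ' (var n) ∷ vars n) ≐
                 app h (var n ∷ app (Rec g h) (var n ∷ vars n) ∷ vars n))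

succAt0 : ℕ → Term
succAt0 zero    = succ' (var zero)
succAt0 (suc x) = var (suc x)

data HAAx₀ : Formula → Set where
  ax-refl  : HAAx₀ (var 0 ≐ var 0)
  ax-eqsub : ∀ φ t u → HAAx₀ ((t ≐ u) ⇒ (φ [ t ] ⇒ φ [ u ]))
  ax-S≠0   : HAAx₀ (¬' (succ' (var 0) ≐ zero'))
  ax-Sinj  : HAAx₀ ((succ' (var 0) ≐ succ' (var 1)) ⇒ (var 0 ≐ var 1))
  ax-pr    : ∀ {φ} → PREq φ → HAAx₀ φ
  ax-ind   : ∀ φ →
    HAAx₀ ((φ [ zero' ] ∧' ∀' (φ ⇒ sub succAt0 φ)) ⇒ ∀' φ)

HA : Formula → Set
HA = UClosure HAAx₀

DNE : (Formula → Set) → Formula → Set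
DNE Γ = UClosure (λ χ → Σ[ φ ∈ Formula ] Γ φ × (χ ≡ (¬' (¬' φ) ⇒ φ)))

_+T_ : (Formula → Set) → (Formula → Set) → Formula → Set
(T +T U) φ = T φ ⊎ U φ

Ctx : Set
Ctx = List Formula

data _⨾_⊢_ (T : Formula → Set) : Ctx → Formula → Set where
  ax   : ∀ {Γ φ} → T φ → T ⨾ Γ ⊢ φ
  hyp  : ∀ {Γ φ} → φ ∈ Γ → T ⨾ Γ ⊢ φ
  ⊥E   : ∀ {Γ φ} → T ⨾ Γ ⊢ ⊥' → T ⨾ Γ ⊢ φ
  ⇒I   : ∀ {Γ φ ψ} → T ⨾ (φ ∷ Γ) ⊢ ψ → T ⨾ Γ ⊢ (φ ⇒ ψ)
  ⇒E   : ∀ {Γ φ ψ} → T ⨾ Γ ⊢ (φ ⇒ ψ) → T ⨾ Γ ⊢ φ → T ⨾ Γ ⊢ ψ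
  ∧I   : ∀ {Γ φ ψ} → T ⨾ Γ ⊢ φ → T ⨾ Γ ⊢ ψ → T ⨾ Γ ⊢ (φ ∧' ψ)
  ∧E₁  : ∀ {Γ φ ψ} → T ⨾ Γ ⊢ (φ ∧' ψ) → T ⨾ Γ ⊢ φ
  ∧E₂  : ∀ {Γ φ ψ} → T ⨾ Γ ⊢ (φ ∧' ψ) → T ⨾ Γ ⊢ ψ
  ∨I₁  : ∀ {Γ φ ψ} → T ⨾ Γ ⊢ φ → T ⨾ Γ ⊢ (φ ∨' ψ)
  ∨I₂  : ∀ {Γ φ ψ} → T ⨾ Γ ⊢ ψ → T ⨾ Γ ⊢ (φ ∨' ψ)
  ∨E   : ∀ {Γ φ ψ χ} → T ⨾ Γ ⊢ (φ ∨' ψ) → T ⨾ (φ ∷ Γ) ⊢ χ → T ⨾ (ψ ∷ Γ) ⊢ χ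
         → T ⨾ Γ ⊢ χ
  ∀I   : ∀ {Γ φ} → T ⨾ List.map shift Γ ⊢ φ → T ⨾ Γ ⊢ ∀' φ
  ∀E   : ∀ {Γ φ} (t : Term) → T ⨾ Γ ⊢ ∀' φ → T ⨾ Γ ⊢ (φ [ t ])
  ∃I   : ∀ {Γ φ} (t : Term) → T ⨾ Γ ⊢ (φ [ t ]) → T ⨾ Γ ⊢ ∃' φ
  ∃E   : ∀ {Γ φ ψ} → T ⨾ Γ ⊢ ∃' φ → T ⨾ (φ ∷ List.map shift Γ) ⊢ shift ψ
         → T ⨾ Γ ⊢ ψ

_⊢_ : (Formula → Set) → Formula → Set
T ⊢ φ = T ⨾ [] ⊢ φ

HA+DNEΣpred : ℕ → Formula → Set
HA+DNEΣpred zero    = HA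
HA+DNEΣpred (suc k) = HA +T DNE (Sig k)

-- Negating a Σ-block ∃x̄ θ gives
-- ∀x̄ ¬θ intuitionistically, and ¬θ is replaced by its Σ-equivalent ψ from the induction
-- hypothesis. Negating a Π-block ∀x̄ θ gives ∃x̄ ψ only classically: ¬∃x̄ ψ yields ∀x̄ ¬¬θ,
-- so ¬∀x̄ θ yields ¬¬∃x̄ ψ, and the two double-negation eliminations used (for θ ∈ Σₖ₋₁
-- and for ∃x̄ ψ ∈ Σₖ) are exactly what HA + DNE(Σₖ) provides.
module Submission where

open import Defs
open import Data.Nat using (ℕ; zero; suc; _<_; _+_; _⊔_; pred)
open import Data.Nat.Properties
  using (m≤m⊔n; m≤n⊔m; ≤-trans; ≤-refl; pred-mono-≤; +-suc; +-identityʳ; m<1+n⇒m<n∨m≡n)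
open import Data.Vec using (Vec; []; _∷_)
open import Data.List using (_∷_; map)
open import Data.List.Membership.Propositional using (_∈_)
open import Data.List.Membership.Propositional.Properties using (∈-map⁺; ∈-map⁻)
open import Data.List.Relation.Unary.Any using (here; there)
open import Data.Product using (Σ-syntax; _×_; _,_; proj₁; proj₂)
open import Data.Sum using (inj₁; inj₂)
open import Relation.Binary.PropositionalEquality
  using (_≡_; refl; sym; trans; cong; cong₂; subst)

Sub : Set
Sub = ℕ → Term

ids : Sub
ids = var

↑ : Sub
↑ x = var (suc x)

_∘ₛ_ : Sub → Sub → Sub
(τ ∘ₛ σ) x = subT τ (σ x)

_∷ₛ_ : Term → Sub → Sub
(t ∷ₛ σ) zero    = t
(t ∷ₛ σ) (suc x) = σ x

mutual
  subT-cong : ∀ {σ τ} t → (∀ x → x ∈FVt t → σ x ≡ τ x) → subT σ t ≡ subT τ t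
  subT-cong (var x)    h = h x fv-var
  subT-cong (app f ts) h = cong (app f) (subTs-cong ts (λ x p → h x (fv-app p)))

  subTs-cong : ∀ {n σ τ} (ts : Vec Term n) →
               (∀ x → x ∈FVts ts → σ x ≡ τ x) → subTs σ ts ≡ subTs τ ts
  subTs-cong []       h = refl
  subTs-cong (t ∷ ts) h =
    cong₂ _∷_ (subT-cong t (λ x p → h x (here p))) (subTs-cong ts (λ x p → h x (there p)))

ext-cong : ∀ {σ τ} {φ : Formula} → (∀ x → suc x ∈FV φ → σ x ≡ τ x) →
           ∀ x → x ∈FV φ → ext σ x ≡ ext τ x
ext-cong h zero    p = refl
ext-cong h (suc x) p = cong shiftT (h x p)

sub-cong : ∀ {σ τ} φ → (∀ x → x ∈FV φ → σ x ≡ τ x) → sub σ φ ≡ sub τ φ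
sub-cong ⊥'       h = refl
sub-cong (t ≐ u)  h =
  cong₂ _≐_ (subT-cong t (λ x p → h x (fv-≐l p))) (subT-cong u (λ x p → h x (fv-≐r p)))
sub-cong (φ ∧' ψ) h =
  cong₂ _∧'_ (sub-cong φ (λ x p → h x (fv-∧l p))) (sub-cong ψ (λ x p → h x (fv-∧r p)))
sub-cong (φ ∨' ψ) h =
  cong₂ _∨'_ (sub-cong φ (λ x p → h x (fv-∨l p))) (sub-cong ψ (λ x p → h x (fv-∨r p)))
sub-cong (φ ⇒ ψ)  h =
  cong₂ _⇒_ (sub-cong φ (λ x p → h x (fv-⇒l p))) (sub-cong ψ (λ x p → h x (fv-⇒r p)))
sub-cong (∀' φ)   h = cong ∀' (sub-cong φ (ext-cong (λ x p → h x (fv-∀ p))))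
sub-cong (∃' φ)   h = cong ∃' (sub-cong φ (ext-cong (λ x p → h x (fv-∃ p))))

mutual
  subT-id : ∀ t → subT ids t ≡ t
  subT-id (var x)    = refl
  subT-id (app f ts) = cong (app f) (subTs-id ts)

  subTs-id : ∀ {n} (ts : Vec Term n) → subTs ids ts ≡ ts
  subTs-id []       = refl
  subTs-id (t ∷ ts) = cong₂ _∷_ (subT-id t) (subTs-id ts)

ext-id : ∀ x → ext ids x ≡ var x
ext-id zero    = refl
ext-id (suc x) = refl

sub-id : ∀ φ → sub ids φ ≡ φ
sub-id ⊥'       = refl
sub-id (t ≐ u)  = cong₂ _≐_ (subT-id t) (subT-id u)
sub-id (φ ∧' ψ) = cong₂ _∧'_ (sub-id φ) (sub-id ψ)
sub-id (φ ∨' ψ) = cong₂ _∨'_ (sub-id φ) (sub-id ψ)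
sub-id (φ ⇒ ψ)  = cong₂ _⇒_ (sub-id φ) (sub-id ψ)
sub-id (∀' φ)   = cong ∀' (trans (sub-cong φ (λ x _ → ext-id x)) (sub-id φ))
sub-id (∃' φ)   = cong ∃' (trans (sub-cong φ (λ x _ → ext-id x)) (sub-id φ))

mutual
  subT-∘ : ∀ τ σ t → subT τ (subT σ t) ≡ subT (τ ∘ₛ σ) t
  subT-∘ τ σ (var x)    = refl
  subT-∘ τ σ (app f ts) = cong (app f) (subTs-∘ τ σ ts)

  subTs-∘ : ∀ {n} τ σ (ts : Vec Term n) → subTs τ (subTs σ ts) ≡ subTs (τ ∘ₛ σ) ts
  subTs-∘ τ σ []       = refl
  subTs-∘ τ σ (t ∷ ts) = cong₂ _∷_ (subT-∘ τ σ t) (subTs-∘ τ σ ts)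

ext-∘ : ∀ τ σ x → (ext τ ∘ₛ ext σ) x ≡ ext (τ ∘ₛ σ) x
ext-∘ τ σ zero    = refl
ext-∘ τ σ (suc x) = trans (subT-∘ (ext τ) ↑ (σ x)) (sym (subT-∘ ↑ τ (σ x)))

sub-∘ : ∀ τ σ φ → sub τ (sub σ φ) ≡ sub (τ ∘ₛ σ) φ
sub-∘ τ σ ⊥'       = refl
sub-∘ τ σ (t ≐ u)  = cong₂ _≐_ (subT-∘ τ σ t) (subT-∘ τ σ u)
sub-∘ τ σ (φ ∧' ψ) = cong₂ _∧'_ (sub-∘ τ σ φ) (sub-∘ τ σ ψ)
sub-∘ τ σ (φ ∨' ψ) = cong₂ _∨'_ (sub-∘ τ σ φ) (sub-∘ τ σ ψ)
sub-∘ τ σ (φ ⇒ ψ)  = cong₂ _⇒_ (sub-∘ τ σ φ) (sub-∘ τ σ ψ)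
sub-∘ τ σ (∀' φ)   =
  cong ∀' (trans (sub-∘ (ext τ) (ext σ) φ) (sub-cong φ (λ x _ → ext-∘ τ σ x)))
sub-∘ τ σ (∃' φ)   =
  cong ∃' (trans (sub-∘ (ext τ) (ext σ) φ) (sub-cong φ (λ x _ → ext-∘ τ σ x)))

[]-ext : ∀ t σ φ → sub (ext σ) φ [ t ] ≡ sub (t ∷ₛ σ) φ
[]-ext t σ φ = trans (sub-∘ (single t) (ext σ) φ) (sub-cong φ pointwise)
  where
  pointwise : ∀ x → x ∈FV φ → (single t ∘ₛ ext σ) x ≡ (t ∷ₛ σ) x
  pointwise zero    _ = refl
  pointwise (suc x) _ = trans (subT-∘ (single t) ↑ (σ x)) (subT-id (σ x))

[var0]-ext↑ : ∀ φ → sub (ext ↑) φ [ var 0 ] ≡ φ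
[var0]-ext↑ φ = trans ([]-ext (var 0) ↑ φ) (trans (sub-cong φ var0∷↑≗ids) (sub-id φ))
  where
  var0∷↑≗ids : ∀ x → x ∈FV φ → (var 0 ∷ₛ ↑) x ≡ var x
  var0∷↑≗ids zero    _ = refl
  var0∷↑≗ids (suc x) _ = refl

mutual
  fvBoundT : Term → ℕ
  fvBoundT (var x)    = suc x
  fvBoundT (app f ts) = fvBoundTs ts

  fvBoundTs : ∀ {n} → Vec Term n → ℕ
  fvBoundTs []       = 0
  fvBoundTs (t ∷ ts) = fvBoundT t ⊔ fvBoundTs ts

mutual
  fvBoundT-correct : ∀ {x} t → x ∈FVt t → x < fvBoundT t
  fvBoundT-correct (var x)    fv-var     = ≤-refl
  fvBoundT-correct (app f ts) (fv-app p) = fvBoundTs-correct ts p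

  fvBoundTs-correct : ∀ {n x} (ts : Vec Term n) → x ∈FVts ts → x < fvBoundTs ts
  fvBoundTs-correct (t ∷ ts) (here p)  = ≤-trans (fvBoundT-correct t p) (m≤m⊔n _ _)
  fvBoundTs-correct (t ∷ ts) (there p) = ≤-trans (fvBoundTs-correct ts p) (m≤n⊔m _ _)

fvBound : Formula → ℕ
fvBound ⊥'       = 0
fvBound (t ≐ u)  = fvBoundT t ⊔ fvBoundT u
fvBound (φ ∧' ψ) = fvBound φ ⊔ fvBound ψ
fvBound (φ ∨' ψ) = fvBound φ ⊔ fvBound ψ
fvBound (φ ⇒ ψ)  = fvBound φ ⊔ fvBound ψ
fvBound (∀' φ)   = pred (fvBound φ)
fvBound (∃' φ)   = pred (fvBound φ)

fvBound-correct : ∀ φ → FVBelow (fvBound φ) φ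
fvBound-correct (t ≐ u)  x (fv-≐l p) = ≤-trans (fvBoundT-correct t p) (m≤m⊔n _ _)
fvBound-correct (t ≐ u)  x (fv-≐r p) = ≤-trans (fvBoundT-correct u p) (m≤n⊔m _ _)
fvBound-correct (φ ∧' ψ) x (fv-∧l p) = ≤-trans (fvBound-correct φ x p) (m≤m⊔n _ _)
fvBound-correct (φ ∧' ψ) x (fv-∧r p) = ≤-trans (fvBound-correct ψ x p) (m≤n⊔m _ _)
fvBound-correct (φ ∨' ψ) x (fv-∨l p) = ≤-trans (fvBound-correct φ x p) (m≤m⊔n _ _)
fvBound-correct (φ ∨' ψ) x (fv-∨r p) = ≤-trans (fvBound-correct ψ x p) (m≤n⊔m _ _)
fvBound-correct (φ ⇒ ψ)  x (fv-⇒l p) = ≤-trans (fvBound-correct φ x p) (m≤m⊔n _ _)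
fvBound-correct (φ ⇒ ψ)  x (fv-⇒r p) = ≤-trans (fvBound-correct ψ x p) (m≤n⊔m _ _)
fvBound-correct (∀' φ)   x (fv-∀ p)  = pred-mono-≤ (fvBound-correct φ (suc x) p)
fvBound-correct (∃' φ)   x (fv-∃ p)  = pred-mono-≤ (fvBound-correct φ (suc x) p)

_⊆_ : Ctx → Ctx → Set
Γ ⊆ Δ = ∀ {φ} → φ ∈ Γ → φ ∈ Δ

map⁺-⊆ : ∀ (f : Formula → Formula) {Γ Δ} → Γ ⊆ Δ → map f Γ ⊆ map f Δ
map⁺-⊆ f Γ⊆Δ p with ∈-map⁻ f p
... | _ , q , refl = ∈-map⁺ f (Γ⊆Δ q)

∷⁺-⊆ : ∀ {φ Γ Δ} → Γ ⊆ Δ → (φ ∷ Γ) ⊆ (φ ∷ Δ)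
∷⁺-⊆ Γ⊆Δ (here e)  = here e
∷⁺-⊆ Γ⊆Δ (there p) = there (Γ⊆Δ p)

⊢-weaken : ∀ {T Γ Δ φ} → Γ ⊆ Δ → T ⨾ Γ ⊢ φ → T ⨾ Δ ⊢ φ
⊢-weaken ρ (ax a)     = ax a
⊢-weaken ρ (hyp p)    = hyp (ρ p)
⊢-weaken ρ (⊥E d)     = ⊥E (⊢-weaken ρ d)
⊢-weaken ρ (⇒I d)     = ⇒I (⊢-weaken (∷⁺-⊆ ρ) d)
⊢-weaken ρ (⇒E d e)   = ⇒E (⊢-weaken ρ d) (⊢-weaken ρ e)
⊢-weaken ρ (∧I d e)   = ∧I (⊢-weaken ρ d) (⊢-weaken ρ e)
⊢-weaken ρ (∧E₁ d)    = ∧E₁ (⊢-weaken ρ d)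
⊢-weaken ρ (∧E₂ d)    = ∧E₂ (⊢-weaken ρ d)
⊢-weaken ρ (∨I₁ d)    = ∨I₁ (⊢-weaken ρ d)
⊢-weaken ρ (∨I₂ d)    = ∨I₂ (⊢-weaken ρ d)
⊢-weaken ρ (∨E d e f) = ∨E (⊢-weaken ρ d) (⊢-weaken (∷⁺-⊆ ρ) e) (⊢-weaken (∷⁺-⊆ ρ) f)
⊢-weaken ρ (∀I d)     = ∀I (⊢-weaken (map⁺-⊆ shift ρ) d)
⊢-weaken ρ (∀E t d)   = ∀E t (⊢-weaken ρ d)
⊢-weaken ρ (∃I t d)   = ∃I t (⊢-weaken ρ d)
⊢-weaken ρ (∃E d e)   = ∃E (⊢-weaken ρ d) (⊢-weaken (∷⁺-⊆ (map⁺-⊆ shift ρ)) e)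

⊢-in-context : ∀ {T Γ φ} → T ⊢ φ → T ⨾ Γ ⊢ φ
⊢-in-context = ⊢-weaken (λ ())

⊢-mono : ∀ {T U : Formula → Set} {Γ φ} → (∀ {ψ} → T ψ → U ψ) → T ⨾ Γ ⊢ φ → U ⨾ Γ ⊢ φ
⊢-mono T⊆U (ax a)     = ax (T⊆U a)
⊢-mono T⊆U (hyp p)    = hyp p
⊢-mono T⊆U (⊥E d)     = ⊥E (⊢-mono T⊆U d)
⊢-mono T⊆U (⇒I d)     = ⇒I (⊢-mono T⊆U d)
⊢-mono T⊆U (⇒E d e)   = ⇒E (⊢-mono T⊆U d) (⊢-mono T⊆U e)
⊢-mono T⊆U (∧I d e)   = ∧I (⊢-mono T⊆U d) (⊢-mono T⊆U e)
⊢-mono T⊆U (∧E₁ d)    = ∧E₁ (⊢-mono T⊆U d)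
⊢-mono T⊆U (∧E₂ d)    = ∧E₂ (⊢-mono T⊆U d)
⊢-mono T⊆U (∨I₁ d)    = ∨I₁ (⊢-mono T⊆U d)
⊢-mono T⊆U (∨I₂ d)    = ∨I₂ (⊢-mono T⊆U d)
⊢-mono T⊆U (∨E d e f) = ∨E (⊢-mono T⊆U d) (⊢-mono T⊆U e) (⊢-mono T⊆U f)
⊢-mono T⊆U (∀I d)     = ∀I (⊢-mono T⊆U d)
⊢-mono T⊆U (∀E t d)   = ∀E t (⊢-mono T⊆U d)
⊢-mono T⊆U (∃I t d)   = ∃I t (⊢-mono T⊆U d)
⊢-mono T⊆U (∃E d e)   = ∃E (⊢-mono T⊆U d) (⊢-mono T⊆U e)

-- Instantiating ∀ⁿ n χ with var (n-1), …, var 0, one quantifier at a time: the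
-- accumulated substitution is  pad n σ x = var x  for x < n,  σ (x ∸ n)  otherwise.
pad : ℕ → Sub → Sub
pad zero    σ = σ
pad (suc n) σ = pad n (var n ∷ₛ σ)

pad-≥ : ∀ n σ y → pad n σ (n + y) ≡ σ y
pad-≥ zero    σ y = refl
pad-≥ (suc n) σ y =
  trans (cong (pad n (var n ∷ₛ σ)) (sym (+-suc n y))) (pad-≥ n (var n ∷ₛ σ) (suc y))

pad-< : ∀ n σ x → x < n → pad n σ x ≡ var x
pad-< (suc n) σ x x<1+n with m<1+n⇒m<n∨m≡n x<1+n
... | inj₁ x<n  = pad-< n (var n ∷ₛ σ) x x<n
... | inj₂ refl = trans (cong (pad n (var n ∷ₛ σ)) (sym (+-identityʳ n))) (pad-≥ n (var n ∷ₛ σ) 0)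

module _ {T : Formula → Set} where

  ∀E-var0 : ∀ {Γ} φ → T ⨾ Γ ⊢ ∀' (sub (ext ↑) φ) → T ⨾ Γ ⊢ φ
  ∀E-var0 {Γ} φ d = subst (T ⨾ Γ ⊢_) ([var0]-ext↑ φ) (∀E (var 0) d)

  ∃I-var0 : ∀ {Γ} φ → T ⨾ Γ ⊢ φ → T ⨾ Γ ⊢ ∃' (sub (ext ↑) φ)
  ∃I-var0 {Γ} φ d = ∃I (var 0) (subst (T ⨾ Γ ⊢_) (sym ([var0]-ext↑ φ)) d)

  ∀ⁿE-pad : ∀ {Γ} n σ χ → T ⨾ Γ ⊢ sub σ (∀ⁿ n χ) → T ⨾ Γ ⊢ sub (pad n σ) χ
  ∀ⁿE-pad zero    σ χ d = d
  ∀ⁿE-pad {Γ} (suc n) σ χ d =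
    ∀ⁿE-pad n (var n ∷ₛ σ) χ (subst (T ⨾ Γ ⊢_) ([]-ext (var n) σ (∀ⁿ n χ)) (∀E (var n) d))

  ∀ⁿE-open : ∀ {Γ} n χ → FVBelow n χ → T ⨾ Γ ⊢ ∀ⁿ n χ → T ⨾ Γ ⊢ χ
  ∀ⁿE-open {Γ} n χ χ<n d = subst (T ⨾ Γ ⊢_) pad≗ids (∀ⁿE-pad n ids χ d′)
    where
    d′ : T ⨾ Γ ⊢ sub ids (∀ⁿ n χ)
    d′ = subst (T ⨾ Γ ⊢_) (sym (sub-id (∀ⁿ n χ))) d
    pad≗ids : sub (pad n ids) χ ≡ χ
    pad≗ids = trans (sub-cong χ (λ x p → pad-< n ids x (χ<n x p))) (sub-id χ)

  ⇒-refl : ∀ {φ} → T ⊢ (φ ⇒ φ)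
  ⇒-refl = ⇒I (hyp (here refl))

  ⇒-trans : ∀ {φ ψ χ} → T ⊢ (φ ⇒ ψ) → T ⊢ (ψ ⇒ χ) → T ⊢ (φ ⇒ χ)
  ⇒-trans f g = ⇒I (⇒E (⊢-in-context g) (⇒E (⊢-in-context f) (hyp (here refl))))

  contraposition : ∀ {φ ψ} → T ⊢ (φ ⇒ ψ) → T ⊢ (¬' ψ ⇒ ¬' φ)
  contraposition f =
    ⇒I (⇒I (⇒E (hyp (there (here refl))) (⇒E (⊢-in-context f) (hyp (here refl)))))

  ∀-mono : ∀ {φ ψ} → T ⊢ (φ ⇒ ψ) → T ⊢ (∀' φ ⇒ ∀' ψ)
  ∀-mono {φ} f = ⇒I (∀I (⇒E (⊢-in-context f) (∀E-var0 φ (hyp (here refl)))))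

  ∃-mono : ∀ {φ ψ} → T ⊢ (φ ⇒ ψ) → T ⊢ (∃' φ ⇒ ∃' ψ)
  ∃-mono {ψ = ψ} f =
    ⇒I (∃E (hyp (here refl)) (∃I-var0 ψ (⇒E (⊢-in-context f) (hyp (here refl)))))

  ∀ⁿ-mono : ∀ m {φ ψ} → T ⊢ (φ ⇒ ψ) → T ⊢ (∀ⁿ m φ ⇒ ∀ⁿ m ψ)
  ∀ⁿ-mono zero    f = f
  ∀ⁿ-mono (suc m) f = ∀-mono (∀ⁿ-mono m f)

  ∃ⁿ-mono : ∀ m {φ ψ} → T ⊢ (φ ⇒ ψ) → T ⊢ (∃ⁿ m φ ⇒ ∃ⁿ m ψ)
  ∃ⁿ-mono zero    f = f
  ∃ⁿ-mono (suc m) f = ∃-mono (∃ⁿ-mono m f)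

  ¬∃⇒∀¬ : ∀ {φ} → T ⊢ (¬' (∃' φ) ⇒ ∀' (¬' φ))
  ¬∃⇒∀¬ {φ} = ⇒I (∀I (⇒I (⇒E (hyp (there (here refl))) (∃I-var0 φ (hyp (here refl))))))

  ∀¬⇒¬∃ : ∀ {φ} → T ⊢ (∀' (¬' φ) ⇒ ¬' (∃' φ))
  ∀¬⇒¬∃ {φ} = ⇒I (⇒I (∃E (hyp (here refl))
    (⇒E (∀E-var0 (¬' φ) (hyp (there (there (here refl))))) (hyp (here refl)))))

  ∃¬⇒¬∀ : ∀ {φ} → T ⊢ (∃' (¬' φ) ⇒ ¬' (∀' φ))
  ∃¬⇒¬∀ {φ} = ⇒I (⇒I (∃E (hyp (there (here refl)))
    (⇒E (hyp (here refl)) (∀E-var0 φ (hyp (there (here refl)))))))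

  ¬∃ⁿ⇒∀ⁿ¬ : ∀ m {φ} → T ⊢ (¬' (∃ⁿ m φ) ⇒ ∀ⁿ m (¬' φ))
  ¬∃ⁿ⇒∀ⁿ¬ zero    = ⇒-refl
  ¬∃ⁿ⇒∀ⁿ¬ (suc m) = ⇒-trans ¬∃⇒∀¬ (∀-mono (¬∃ⁿ⇒∀ⁿ¬ m))

  ∀ⁿ¬⇒¬∃ⁿ : ∀ m {φ} → T ⊢ (∀ⁿ m (¬' φ) ⇒ ¬' (∃ⁿ m φ))
  ∀ⁿ¬⇒¬∃ⁿ zero    = ⇒-refl
  ∀ⁿ¬⇒¬∃ⁿ (suc m) = ⇒-trans (∀-mono (∀ⁿ¬⇒¬∃ⁿ m)) ∀¬⇒¬∃

  ∃ⁿ¬⇒¬∀ⁿ : ∀ m {φ} → T ⊢ (∃ⁿ m (¬' φ) ⇒ ¬' (∀ⁿ m φ))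
  ∃ⁿ¬⇒¬∀ⁿ zero    = ⇒-refl
  ∃ⁿ¬⇒¬∀ⁿ (suc m) = ⇒-trans (∃-mono (∃ⁿ¬⇒¬∀ⁿ m)) ∃¬⇒¬∀

  ¬∃ⁿ⇔∀ⁿ : ∀ m {θ ψ} → T ⊢ (¬' θ ⇔ ψ) → T ⊢ (¬' (∃ⁿ m θ) ⇔ ∀ⁿ m ψ)
  ¬∃ⁿ⇔∀ⁿ m ¬θ⇔ψ =
    ∧I (⇒-trans (¬∃ⁿ⇒∀ⁿ¬ m) (∀ⁿ-mono m (∧E₁ ¬θ⇔ψ)))
       (⇒-trans (∀ⁿ-mono m (∧E₂ ¬θ⇔ψ)) (∀ⁿ¬⇒¬∃ⁿ m))

  ¬∀ⁿ⇔∃ⁿ : ∀ m {θ ψ} → T ⊢ (¬' (¬' θ) ⇒ θ) → T ⊢ (¬' (¬' (∃ⁿ m ψ)) ⇒ ∃ⁿ m ψ) →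
           T ⊢ (¬' θ ⇔ ψ) → T ⊢ (¬' (∀ⁿ m θ) ⇔ ∃ⁿ m ψ)
  ¬∀ⁿ⇔∃ⁿ m {θ} {ψ} stable-θ stable-∃ψ ¬θ⇔ψ =
    ∧I (⇒-trans (contraposition ¬∃ψ⇒∀θ) stable-∃ψ)
       (⇒-trans (∃ⁿ-mono m (∧E₂ ¬θ⇔ψ)) (∃ⁿ¬⇒¬∀ⁿ m))
    where
    ¬∃ψ⇒∀θ : T ⊢ (¬' (∃ⁿ m ψ) ⇒ ∀ⁿ m θ)
    ¬∃ψ⇒∀θ = ⇒-trans (¬∃ⁿ⇒∀ⁿ¬ m)
               (∀ⁿ-mono m (⇒-trans (contraposition (∧E₁ ¬θ⇔ψ)) stable-θ))

mutual
  Sig⇒Sig-suc : ∀ {k φ} → Sig k φ → Sig (suc k) φ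
  Sig⇒Sig-suc (sig0 q)   = sigS 0 (pi0 q)
  Sig⇒Sig-suc (sigS m p) = sigS m (Pi⇒Pi-suc p)

  Pi⇒Pi-suc : ∀ {k φ} → Pi k φ → Pi (suc k) φ
  Pi⇒Pi-suc (pi0 q)   = piS 0 (sig0 q)
  Pi⇒Pi-suc (piS m s) = piS m (Sig⇒Sig-suc s)

DNE-mono : ∀ {Γ Δ : Formula → Set} → (∀ {φ} → Γ φ → Δ φ) → ∀ {ψ} → DNE Γ ψ → DNE Δ ψ
DNE-mono Γ⊆Δ (n , χ , (φ , γφ , χ≡) , χ<n , ψ≡) = n , χ , (φ , Γ⊆Δ γφ , χ≡) , χ<n , ψ≡

HA+DNEΣpred⊆HA+DNEΣ-suc : ∀ k {φ} → HA+DNEΣpred k φ → (HA +T DNE (Sig (suc k))) φ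
HA+DNEΣpred⊆HA+DNEΣ-suc zero    ha       = inj₁ ha
HA+DNEΣpred⊆HA+DNEΣ-suc (suc k) (inj₁ ha)  = inj₁ ha
HA+DNEΣpred⊆HA+DNEΣ-suc (suc k) (inj₂ dne) =
  inj₂ (DNE-mono (λ s → Sig⇒Sig-suc (Sig⇒Sig-suc s)) dne)

DNE-open : ∀ {Γ : Formula → Set} {T : Formula → Set} → (∀ {φ} → DNE Γ φ → T φ) →
           ∀ φ → Γ φ → T ⊢ (¬' (¬' φ) ⇒ φ)
DNE-open DNE⊆T φ γφ =
  ∀ⁿE-open n χ (fvBound-correct χ) (ax (DNE⊆T (n , χ , (φ , γφ , refl) , fvBound-correct χ , refl)))
  where
  χ = ¬' (¬' φ) ⇒ φ
  n = fvBound χ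

¬-SameFV : ∀ φ → SameFV φ (¬' φ)
¬-SameFV φ x = fv-⇒l , λ { (fv-⇒l p) → p ; (fv-⇒r ()) }

∀ⁿ-∃ⁿ-SameFV : ∀ m {θ ψ} → SameFV θ ψ → SameFV (∀ⁿ m θ) (∃ⁿ m ψ)
∀ⁿ-∃ⁿ-SameFV zero    θ~ψ = θ~ψ
∀ⁿ-∃ⁿ-SameFV (suc m) θ~ψ x =
  (λ { (fv-∀ p) → fv-∃ (proj₁ (∀ⁿ-∃ⁿ-SameFV m θ~ψ (suc x)) p) }) ,
  (λ { (fv-∃ p) → fv-∀ (proj₂ (∀ⁿ-∃ⁿ-SameFV m θ~ψ (suc x)) p) })

SameFV-sym : ∀ {φ ψ} → SameFV φ ψ → SameFV ψ φ
SameFV-sym φ~ψ x = proj₂ (φ~ψ x) , proj₁ (φ~ψ x)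

∃ⁿ-∀ⁿ-SameFV : ∀ m {θ ψ} → SameFV θ ψ → SameFV (∃ⁿ m θ) (∀ⁿ m ψ)
∃ⁿ-∀ⁿ-SameFV m θ~ψ = SameFV-sym (∀ⁿ-∃ⁿ-SameFV m (SameFV-sym θ~ψ))

mutual
  ¬Pi-as-Sig : ∀ k φ → Pi k φ →
    Σ[ ψ ∈ Formula ] Sig k ψ × SameFV φ ψ × ((HA +T DNE (Sig k)) ⊢ (¬' φ ⇔ ψ))
  ¬Pi-as-Sig zero φ (pi0 q) = ¬' φ , sig0 (qf-⇒ q qf-⊥) , ¬-SameFV φ , ∧I ⇒-refl ⇒-refl
  ¬Pi-as-Sig (suc k) .(∀ⁿ m θ) (piS m {θ} θ∈Σ) with ¬Sig-as-Pi k θ θ∈Σ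
  ... | ψ , ψ∈Π , θ~ψ , ¬θ⇔ψ =
    ∃ⁿ m ψ , sigS m ψ∈Π , ∀ⁿ-∃ⁿ-SameFV m θ~ψ ,
    ¬∀ⁿ⇔∃ⁿ m (stable θ (Sig⇒Sig-suc θ∈Σ)) (stable (∃ⁿ m ψ) (sigS m ψ∈Π))
             (⊢-mono (HA+DNEΣpred⊆HA+DNEΣ-suc k) ¬θ⇔ψ)
    where
    stable = DNE-open {Sig (suc k)} inj₂

  ¬Sig-as-Pi : ∀ k φ → Sig k φ →
    Σ[ ψ ∈ Formula ] Pi k ψ × SameFV φ ψ × (HA+DNEΣpred k ⊢ (¬' φ ⇔ ψ))
  ¬Sig-as-Pi zero φ (sig0 q) = ¬' φ , pi0 (qf-⇒ q qf-⊥) , ¬-SameFV φ , ∧I ⇒-refl ⇒-refl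
  ¬Sig-as-Pi (suc k) .(∃ⁿ m θ) (sigS m {θ} θ∈Π) with ¬Pi-as-Sig k θ θ∈Π
  ... | ψ , ψ∈Σ , θ~ψ , ¬θ⇔ψ = ∀ⁿ m ψ , piS m ψ∈Σ , ∃ⁿ-∀ⁿ-SameFV m θ~ψ , ¬∃ⁿ⇔∀ⁿ m ¬θ⇔ψ

lemma4p7 : (k : ℕ) →
    (∀ φ → Pi k φ →
      Σ[ ψ ∈ Formula ] Sig k ψ × SameFV φ ψ × ((HA +T DNE (Sig k)) ⊢ (¬' φ ⇔ ψ)))
    ×
    (∀ φ → Sig k φ →
      Σ[ ψ ∈ Formula ] Pi k ψ × SameFV φ ψ × (HA+DNEΣpred k ⊢ (¬' φ ⇔ ψ)))
lemma4p7 k = ¬Pi-as-Sig k , ¬Sig-as-Pi k
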